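{- Let $n\ge1$. Order $\mathrm{Par}(n)$ by $\mu\preceq\lambda$ iff $\mu^\vee\le_{\mathrm{lex}}\lambda^\vee$. Then the matrix $(A(\lambda,\mu))_{\lambda,\mu\in\mathrm{Par}(n)}$, where $A(\lambda,\mu)=|\mathcal{D}(\mathbb{J}_\lambda,J_\mu)|$, written with respect to this total order is upper-triangular with $1$'s on the diagonal. Equivalently, for $\lambda,\mu\in\mathrm{Par}(n)$: (1) if $\mu\prec\lambda$ then $\mathcal{D}(\mathbb{J}_\lambda,J_\mu)=\emptyset$, so $A(\lambda,\mu)=0$; (2) $\mathcal{D}(\mathbb{J}_\lambda,J_\lambda)$ has exactly one element, so $A(\lambda,\lambda)=1$.
   Context: $\mathrm{Par}(n)$ is the set of partitions of $n$; $\lambda^\vee$ denotes the dual (conjugate) partition and $\le_{\mathrm{lex}}$ the lexicographic order on sequences. $\Delta=\{\alpha_1,\dots,\alpha_{n-1}\}$ (simple roots, $\alpha_j=t_j-t_{j+1}$). For $w\in\mathfrak{S}_n$: $\mathrm{Des}_L(w)=\{\alpha_j:w^{ -1}(j)>w^{ -1}(j+1)\}$, $\mathrm{Des}_R(w)=\{\alpha_j:w(j)>w(j+1)\}$. For $J,K\subseteq\Delta$, $\mathcal{D}(J,K)=\{w\in\mathfrak{S}_n:\mathrm{Des}_L(w)=\Delta\setminus J,\ \mathrm{Des}_R(w)\subseteq\Delta\setminus K\}$. For $\mu=(\mu_1,\dots,\mu_k)\vdash n$ with $k$ parts, $J_\mu=\Delta\setminus\{\alpha_{\mu_1},\alpha_{\mu_1+\mu_2},\dots,\alpha_{\mu_1+\cdots+\mu_{k-1}}\}$,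 and $\mathbb{J}_\lambda=\Delta\setminus J_{\lambda^\vee}$. -}

module Defs where

open import Data.Nat using (ℕ; zero; suc; _+_; _≤_; _<_; _≤?_; _⊔_)
open import Data.Nat.ListAction using (sum)
open import Data.List using (List; []; _∷_; map; length; filter; upTo; foldr)
open import Data.List.Relation.Unary.All using (All)
open import Data.List.Relation.Unary.Linked using (Linked)
open import Data.List.Relation.Binary.Lex.Strict using (Lex-<)
open import Data.List.Membership.Propositional using (_∈_)
open import Data.Fin using (Fin; toℕ; fromℕ<)
open import Data.Fin.Permutation using (Permutation′; _⟨$⟩ʳ_; _⟨$⟩ˡ_)
open import Data.Product using (_×_)
open import Relation.Nullary using (¬_)
open import Relation.Binary.PropositionalEquality using (_≡_)
open import Function.Bundles using (_⇔_)
open import Data.Nat.Properties using (<-trans; n<1+n)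

record Par (n : ℕ) : Set where
  constructor mkPar
  field
    parts     : List ℕ
    decreasing : Linked (λ a b → b ≤ a) parts
    positive  : All (λ p → 0 < p) parts
    sums      : sum parts ≡ n
open Par public

dual : List ℕ → List ℕ
dual l = map (λ i → length (filter (λ p → suc i ≤? p) l)) (upTo (foldr _⊔_ 0 l))

_<lex_ : List ℕ → List ℕ → Set
_<lex_ = Lex-< _≡_ _<_

_≺_ : ∀ {n} → Par n → Par n → Set
μ ≺ λ′ = dual (parts μ) <lex dual (parts λ′)

-- Subsets of Δ, with α_j identified with its index j (1 ≤ j ≤ n-1)
RootSet : Set₁
RootSet = ℕ → Set

properPartialSums : List ℕ → List ℕ
properPartialSums []            = []
properPartialSums (x ∷ [])      = []
properPartialSums (x ∷ y ∷ r)   = x ∷ map (x +_) (properPartialSums (y ∷ r))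

J : List ℕ → RootSet
J μ j = ¬ (j ∈ properPartialSums μ)

𝕁 : List ℕ → RootSet
𝕁 l j = ¬ (J (dual l) j)

-- positions/values are 0-indexed Fin n; the simple root α_{k+1} (k+1 < n)
-- compares positions (resp. values) k and k+1.
module _ {n : ℕ} where
  fin : (k : ℕ) → k < n → Fin n
  fin k h = fromℕ< h

  InDesL : Permutation′ n → (k : ℕ) → suc k < n → Set
  InDesL w k h = toℕ (w ⟨$⟩ˡ fin (suc k) h) < toℕ (w ⟨$⟩ˡ fin k (<-trans (n<1+n k) h))

  InDesR : Permutation′ n → (k : ℕ) → suc k < n → Set
  InDesR w k h = toℕ (w ⟨$⟩ʳ fin (suc k) h) < toℕ (w ⟨$⟩ʳ fin k (<-trans (n<1+n k) h))

InD : (n : ℕ) → RootSet → RootSet → Permutation′ n → Set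
InD n Jset Kset w =
  (∀ k (h : suc k < n) → InDesL w k h ⇔ (¬ Jset (suc k))) ×
  (∀ k (h : suc k < n) → InDesR w k h → ¬ Kset (suc k))

_≈ₚ_ : ∀ {n} → Permutation′ n → Permutation′ n → Set
w ≈ₚ v = ∀ i → w ⟨$⟩ʳ i ≡ v ⟨$⟩ʳ i

module Submission where

-- Put a = λ^∨.  Positions 0 … n-1 are cut into the consecutive blocks of μ,
-- values into the consecutive blocks of a.  For w ∈ 𝒟(𝕁_λ, J_μ) the descent
-- conditions say exactly: w⁻¹ decreases inside every a-block of values, and
-- w increases inside every μ-block of positions.  So the first r+1 entries of
-- a μ-block go to r+1 distinct a-blocks in increasing order, and the position
-- with offset r in its μ-block lands in an a-block of index ≥ r
-- (`offset≤block`).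
--   (1) Counting positions sent into the first t+1 a-blocks gives
--       a_0+⋯+a_t ≤ Σ_j min(t+1, μ_j) = μ^∨_0+⋯+μ^∨_t for all t, which is
--       impossible when μ^∨ <lex λ^∨ (`vanishing`).
--   (2) For μ = λ, summing the inequality over all positions forces equality,
--       so w sends column r of the Young diagram of λ onto a-block r, and
--       reversely ordered down the column: w is the permutation π₀ of the
--       module `Diagram`, which does lie in 𝒟(𝕁_λ, J_λ).

open import Defs
open import Data.Fin using (Fin; toℕ; fromℕ<)
open import Data.Fin.Properties using (toℕ<n; fromℕ<-cong; fromℕ<-toℕ; toℕ-fromℕ<; toℕ-injective)
open import Data.Fin.Permutation using (Permutation′; _⟨$⟩ʳ_; _⟨$⟩ˡ_; permutation; inverseˡ)
import Data.Fin as Fin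
import Data.Vec.Functional as VF
open import Data.Nat using (ℕ; zero; suc; _+_; _*_; _∸_; _≤_; _<_; _≤?_; _<?_; _⊔_; _⊓_; z≤n; s≤s; z<s)
open import Data.Nat.Properties
open import Data.Nat.ListAction using (sum)
open import Algebra.Properties.CommutativeSemigroup +-commutativeSemigroup using (interchange)
open import Algebra.Properties.CommutativeMonoid.Sum +-0-commutativeMonoid using (∑-permute)
open import Data.List using (List; []; _∷_; map; length; filter; foldr; applyUpTo)
import Data.List.Properties as List
open import Data.List.Membership.Propositional using (_∈_)
open import Data.List.Membership.Propositional.Properties using (∈-map⁻; ∈-map⁺)
open import Data.List.Relation.Unary.Any using (here; there)
open import Data.List.Relation.Unary.All using (All; []; _∷_)
import Data.List.Relation.Unary.All as All
open import Data.List.Relation.Unary.All.Properties using (applyUpTo⁺₁; map⁺)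
open import Data.List.Relation.Unary.Linked using (Linked; []; [-]; _∷_)
import Data.List.Relation.Unary.Linked as Linked
open import Data.List.Relation.Unary.Linked.Properties using (Linked⇒All)
open import Data.List.Relation.Binary.Lex.Core using (halt; this; next)
open import Data.Product using (_×_; _,_; proj₁; proj₂; ∃-syntax)
open import Data.Sum using (inj₁; inj₂)
open import Data.Empty using (⊥-elim)
open import Relation.Binary.Definitions using (tri<; tri≈; tri>)
open import Relation.Nullary using (¬_; yes; no)
open import Function.Bundles using (_⇔_; mk⇔; Equivalence)
open import Relation.Binary.PropositionalEquality hiding (J)

∑ : ℕ → (ℕ → ℕ) → ℕ
∑ zero    f = 0
∑ (suc n) f = f 0 + ∑ n (λ x → f (suc x))

∑-cong : ∀ n {f g : ℕ → ℕ} → (∀ x → x < n → f x ≡ g x) → ∑ n f ≡ ∑ n g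
∑-cong zero    e = refl
∑-cong (suc n) e = cong₂ _+_ (e 0 z<s) (∑-cong n (λ x p → e (suc x) (s≤s p)))

∑-mono-≤ : ∀ n {f g : ℕ → ℕ} → (∀ x → x < n → f x ≤ g x) → ∑ n f ≤ ∑ n g
∑-mono-≤ zero    le = z≤n
∑-mono-≤ (suc n) le = +-mono-≤ (le 0 z<s) (∑-mono-≤ n (λ x p → le (suc x) (s≤s p)))

∑-split : ∀ m k (f : ℕ → ℕ) → ∑ (m + k) f ≡ ∑ m f + ∑ k (λ x → f (m + x))
∑-split zero    k f = refl
∑-split (suc m) k f = trans (cong (f 0 +_) (∑-split m k (λ x → f (suc x)))) (sym (+-assoc (f 0) _ _))

∑-const : ∀ n c → ∑ n (λ _ → c) ≡ n * c
∑-const zero    c = refl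
∑-const (suc n) c = cong (c +_) (∑-const n c)

∑-+ : ∀ n (f g : ℕ → ℕ) → ∑ n (λ i → f i + g i) ≡ ∑ n f + ∑ n g
∑-+ zero    f g = refl
∑-+ (suc n) f g = trans (cong (f 0 + g 0 +_) (∑-+ n (λ i → f (suc i)) (λ i → g (suc i))))
                        (interchange (f 0) (g 0) _ _)

+-≤-equality : ∀ {a b c d} → a ≤ b → c ≤ d → a + c ≡ b + d → a ≡ b × c ≡ d
+-≤-equality {a} {b} {c} {d} a≤b c≤d e = a≡b , +-cancelˡ-≡ a c d (trans e (cong (_+ d) (sym a≡b)))
  where
  a≡b : a ≡ b
  a≡b = ≤-antisym a≤b (+-cancelʳ-≤ c b a (subst (b + c ≤_) (sym e) (+-monoʳ-≤ b c≤d)))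

∑-≤-equality : ∀ n {f g : ℕ → ℕ} → (∀ x → x < n → f x ≤ g x) → ∑ n f ≡ ∑ n g →
               ∀ x → x < n → f x ≡ g x
∑-≤-equality (suc n) le e x x<n with +-≤-equality (le 0 z<s) (∑-mono-≤ n (λ y q → le (suc y) (s≤s q))) e
∑-≤-equality (suc n) le e zero    _         | e₀ , _ = e₀
∑-≤-equality (suc n) le e (suc x) (s≤s x<n) | _ , e₁ = ∑-≤-equality n (λ y q → le (suc y) (s≤s q)) e₁ x x<n

∑-<-first-difference : ∀ t (f g : ℕ → ℕ) → (∀ i → i < t → f i ≡ g i) → f t < g t →
                       ∑ (suc t) f < ∑ (suc t) g
∑-<-first-difference zero    f g e lt = +-monoˡ-< 0 lt
∑-<-first-difference (suc t) f g e lt = subst (λ z → z + _ < g 0 + _) (sym (e 0 z<s))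
  (+-monoʳ-< (g 0) (∑-<-first-difference t (λ i → f (suc i)) (λ i → g (suc i)) (λ i q → e (suc i) (s≤s q)) lt))

ind : ℕ → ℕ → ℕ
ind i       zero    = 0
ind zero    (suc x) = 1
ind (suc i) (suc x) = ind i x

ind≤1 : ∀ i x → ind i x ≤ 1
ind≤1 i       zero    = z≤n
ind≤1 zero    (suc x) = ≤-refl
ind≤1 (suc i) (suc x) = ind≤1 i x

ind-antitone : ∀ {i j} x → i ≤ j → ind j x ≤ ind i x
ind-antitone zero p = z≤n
ind-antitone {zero}  {j}     (suc x) p       = ind≤1 j (suc x)
ind-antitone {suc i} {suc j} (suc x) (s≤s p) = ind-antitone x p

ind-< : ∀ {i x} → i < x → ind i x ≡ 1
ind-< {zero}  {suc x} p       = refl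
ind-< {suc i} {suc x} (s≤s p) = ind-< p

ind-≥ : ∀ {i x} → x ≤ i → ind i x ≡ 0
ind-≥ {i}     {zero}  p       = refl
ind-≥ {suc i} {suc x} (s≤s p) = ind-≥ p

∑-ind : ∀ m x → ∑ m (λ i → ind i x) ≡ m ⊓ x
∑-ind zero    x       = refl
∑-ind (suc m) zero    = trans (∑-const m 0) (*-zeroʳ m)
∑-ind (suc m) (suc x) = cong suc (∑-ind m x)

-- Block decomposition along a composition.  A list l cuts {0, …, sum l ∸ 1}
-- into consecutive blocks of sizes l_0, l_1, …; y lies in block `block l y`
-- at offset `offset l y`.

-- get l i = l_i, and 0 beyond the end of l
get : List ℕ → ℕ → ℕ
get []      _       = 0
get (x ∷ l) zero    = x
get (x ∷ l) (suc i) = get l i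

-- psum l j = l_0 + ⋯ + l_(j-1), the first element of block j
psum : List ℕ → ℕ → ℕ
psum l       zero    = 0
psum []      (suc j) = 0
psum (x ∷ l) (suc j) = x + psum l j

block : List ℕ → ℕ → ℕ
block []      y = 0
block (x ∷ l) y with y <? x
... | yes _ = 0
... | no  _ = suc (block l (y ∸ x))

offset : List ℕ → ℕ → ℕ
offset []      y = y
offset (x ∷ l) y with y <? x
... | yes _ = y
... | no  _ = offset l (y ∸ x)

psum-block+offset : ∀ l y → psum l (block l y) + offset l y ≡ y
psum-block+offset []      y = refl
psum-block+offset (x ∷ l) y with y <? x
... | yes _ = refl
... | no q  = trans (+-assoc x _ _) (trans (cong (x +_) (psum-block+offset l (y ∸ x))) (m+[n∸m]≡n (≮⇒≥ q)))

offset<get : ∀ l y → y < sum l → offset l y < get l (block l y)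
offset<get (x ∷ l) y p with y <? x
... | yes q = q
... | no q  = offset<get l (y ∸ x) (subst (y ∸ x <_) (m+n∸m≡n x (sum l)) (∸-monoˡ-< p (≮⇒≥ q)))

block-offset-cell : ∀ l i p → p < get l i → block l (psum l i + p) ≡ i × offset l (psum l i + p) ≡ p
block-offset-cell (x ∷ l) zero p q with p <? x
... | yes _ = refl , refl
... | no r  = ⊥-elim (r q)
block-offset-cell (x ∷ l) (suc i) p q with x + psum l i + p <? x
... | yes r = ⊥-elim (<⇒≱ r (≤-trans (m≤m+n x _) (m≤m+n _ p)))
... | no _ rewrite +-assoc x (psum l i) p | m+n∸m≡n x (psum l i + p)
              with block-offset-cell l i p q
...   | e₁ , e₂ = cong suc e₁ , e₂

offset-0 : ∀ l → offset l 0 ≡ 0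
offset-0 []      = refl
offset-0 (x ∷ l) with 0 <? x
... | yes _ = refl
... | no _ rewrite 0∸n≡0 x = offset-0 l

block-mono : ∀ l {y y′} → y ≤ y′ → block l y ≤ block l y′
block-mono []      p = z≤n
block-mono (x ∷ l) {y} {y′} p with y <? x | y′ <? x
... | yes _ | _      = z≤n
... | no q  | yes q′ = ⊥-elim (q (≤-<-trans p q′))
... | no q  | no q′  = s≤s (block-mono l (∸-monoˡ-≤ x p))

offset-step : ∀ l y → offset l (suc y) ≢ 0 → block l (suc y) ≡ block l y × offset l (suc y) ≡ suc (offset l y)
offset-step []      y nz = refl , refl
offset-step (x ∷ l) y nz with suc y <? x | y <? x
... | yes _ | yes _ = refl , refl
... | yes p | no q  = ⊥-elim (q (<-trans (n<1+n y) p))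
... | no p  | yes q = ⊥-elim (nz (subst (λ k → offset l k ≡ 0)
                        (sym (trans (cong (_∸ x) (≤-antisym q (≮⇒≥ p))) (n∸n≡0 x))) (offset-0 l)))
... | no p  | no q rewrite +-∸-assoc 1 (≮⇒≥ q) with offset-step l (y ∸ x) nz
...   | e₁ , e₂ = cong suc e₁ , e₂

offset-wrap : ∀ l y → offset l (suc y) ≡ 0 → block l y < block l (suc y) × suc (offset l y) ≡ get l (block l y)
offset-wrap (x ∷ l) y z with suc y <? x | y <? x
... | yes _ | yes _ = ⊥-elim (0≢1+n (sym z))
... | yes p | no q  = ⊥-elim (q (<-trans (n<1+n y) p))
... | no p  | yes q = z<s , ≤-antisym q (≮⇒≥ p)
... | no p  | no q rewrite +-∸-assoc 1 (≮⇒≥ q) with offset-wrap l (y ∸ x) z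
...   | e₁ , e₂ = s≤s e₁ , e₂

psum-suc : ∀ l j → psum l j + get l j ≡ psum l (suc j)
psum-suc []      zero    = refl
psum-suc []      (suc j) = refl
psum-suc (x ∷ l) zero    = +-comm 0 x
psum-suc (x ∷ l) (suc j) = trans (+-assoc x _ _) (cong (x +_) (psum-suc l j))

psum≤sum : ∀ l j → psum l j ≤ sum l
psum≤sum l       zero    = z≤n
psum≤sum []      (suc j) = z≤n
psum≤sum (x ∷ l) (suc j) = +-monoʳ-≤ x (psum≤sum l j)

cell<sum : ∀ l j r → r < get l j → psum l j + r < sum l
cell<sum l j r p = <-≤-trans (+-monoʳ-< (psum l j) p) (subst (_≤ sum l) (sym (psum-suc l j)) (psum≤sum l (suc j)))

∑-get : ∀ k l → ∑ k (get l) ≡ psum l k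
∑-get zero    l       = refl
∑-get (suc k) []      = trans (∑-const k 0) (*-zeroʳ k)
∑-get (suc k) (x ∷ l) = cong (x +_) (∑-get k l)

boundary⇒offset≡0-cons : ∀ x y l →
  (∀ z → z ∈ properPartialSums (y ∷ l) → offset (y ∷ l) z ≡ 0) →
  ∀ z → z ∈ properPartialSums (x ∷ y ∷ l) → offset (x ∷ y ∷ l) z ≡ 0
boundary⇒offset≡0-cons x y l ih z (here refl) with x <? x
... | yes q = ⊥-elim (<-irrefl refl q)
... | no _ rewrite n∸n≡0 x = offset-0 (y ∷ l)
boundary⇒offset≡0-cons x y l ih z (there m) with ∈-map⁻ (x +_) m
... | z′ , m′ , refl with x + z′ <? x
...   | yes q = ⊥-elim (<⇒≱ q (m≤m+n x z′))
...   | no _ rewrite m+n∸m≡n x z′ = ih z′ m′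

boundary⇒offset≡0 : ∀ l z → z ∈ properPartialSums l → offset l z ≡ 0
boundary⇒offset≡0 (x ∷ y ∷ l) = boundary⇒offset≡0-cons x y l (boundary⇒offset≡0 (y ∷ l))

offset≡0⇒boundary-cons : ∀ x y l →
  (∀ z → 0 < z → z < sum (y ∷ l) → offset (y ∷ l) z ≡ 0 → z ∈ properPartialSums (y ∷ l)) →
  ∀ z → 0 < z → z < sum (x ∷ y ∷ l) → offset (x ∷ y ∷ l) z ≡ 0 → z ∈ properPartialSums (x ∷ y ∷ l)
offset≡0⇒boundary-cons x y l ih z p q h with z <? x
... | yes _ rewrite h = ⊥-elim (<-irrefl refl p)
... | no r with m≤n⇒m<n∨m≡n (≮⇒≥ r)
...   | inj₂ x≡z = here (sym x≡z)
...   | inj₁ x<z = there (subst (_∈ map (x +_) (properPartialSums (y ∷ l))) (m+[n∸m]≡n (≮⇒≥ r))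
          (∈-map⁺ (x +_) (ih (z ∸ x) (m<n⇒0<n∸m x<z) (subst (z ∸ x <_) (m+n∸m≡n x _) (∸-monoˡ-< q (≮⇒≥ r))) h)))

offset≡0⇒boundary : ∀ l z → 0 < z → z < sum l → offset l z ≡ 0 → z ∈ properPartialSums l
offset≡0⇒boundary (x ∷ []) z p q h with z <? x
... | yes _ rewrite h = ⊥-elim (<-irrefl refl p)
... | no r = ⊥-elim (r (subst (z <_) (+-identityʳ x) q))
offset≡0⇒boundary (x ∷ y ∷ l) = offset≡0⇒boundary-cons x y l (offset≡0⇒boundary (y ∷ l))

count-blocks≤ : ∀ l t → ∑ (sum l) (λ y → ind (block l y) (suc t)) ≡ psum l (suc t)
count-blocks≤ []      t = refl
count-blocks≤ (x ∷ l) t = trans (∑-split x (sum l) _) (cong₂ _+_ first-block (later-blocks t))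
  where
  first-block : ∑ x (λ y → ind (block (x ∷ l) y) (suc t)) ≡ x
  first-block = trans (∑-cong x inside) (trans (∑-const x 1) (*-identityʳ x))
    where
    inside : ∀ y → y < x → ind (block (x ∷ l) y) (suc t) ≡ 1
    inside y q with y <? x
    ... | yes _ = refl
    ... | no r  = ⊥-elim (r q)
  shift : ∀ s y → ind (block (x ∷ l) (x + y)) (suc s) ≡ ind (suc (block l y)) (suc s)
  shift s y with x + y <? x
  ... | yes q = ⊥-elim (<⇒≱ q (m≤m+n x y))
  ... | no _ rewrite m+n∸m≡n x y = refl
  later-blocks : ∀ s → ∑ (sum l) (λ y → ind (block (x ∷ l) (x + y)) (suc s)) ≡ psum l s
  later-blocks zero    = trans (∑-cong (sum l) (λ y _ → shift zero y)) (trans (∑-const (sum l) 0) (*-zeroʳ (sum l)))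
  later-blocks (suc s) = trans (∑-cong (sum l) (λ y _ → shift (suc s) y)) (count-blocks≤ l s)

minSum : ℕ → List ℕ → ℕ
minSum m []      = 0
minSum m (x ∷ l) = m ⊓ x + minSum m l

count-offsets≤ : ∀ l t → ∑ (sum l) (λ y → ind (offset l y) (suc t)) ≡ minSum (suc t) l
count-offsets≤ []      t = refl
count-offsets≤ (x ∷ l) t = trans (∑-split x (sum l) _) (cong₂ _+_ first-block later-blocks)
  where
  first-block : ∑ x (λ y → ind (offset (x ∷ l) y) (suc t)) ≡ suc t ⊓ x
  first-block = trans (∑-cong x inside) (trans (∑-ind x (suc t)) (⊓-comm x (suc t)))
    where
    inside : ∀ y → y < x → ind (offset (x ∷ l) y) (suc t) ≡ ind y (suc t)
    inside y q with y <? x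
    ... | yes _ = refl
    ... | no r  = ⊥-elim (r q)
  shift : ∀ y → ind (offset (x ∷ l) (x + y)) (suc t) ≡ ind (offset l y) (suc t)
  shift y with x + y <? x
  ... | yes q = ⊥-elim (<⇒≱ q (m≤m+n x y))
  ... | no _ rewrite m+n∸m≡n x y = refl
  later-blocks : ∑ (sum l) (λ y → ind (offset (x ∷ l) (x + y)) (suc t)) ≡ minSum (suc t) l
  later-blocks = trans (∑-cong (sum l) (λ y _ → shift y)) (count-offsets≤ l t)

conj : ℕ → List ℕ → ℕ
conj i l = length (filter (λ p → suc i ≤? p) l)

maxPart : List ℕ → ℕ
maxPart l = foldr _⊔_ 0 l

conj-cons : ∀ i x l → conj i (x ∷ l) ≡ ind i x + conj i l
conj-cons i x l with suc i ≤? x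
... | yes p rewrite ind-< p | List.filter-accept (λ q → suc i ≤? q) {x} {l} p = refl
... | no p  rewrite ind-≥ (≮⇒≥ p) | List.filter-reject (λ q → suc i ≤? q) {x} {l} p = refl

conj-beyond-max : ∀ i l → maxPart l ≤ i → conj i l ≡ 0
conj-beyond-max i []      p = refl
conj-beyond-max i (x ∷ l) p rewrite conj-cons i x l | ind-≥ (≤-trans (m≤m⊔n x (maxPart l)) p) =
  conj-beyond-max i l (≤-trans (m≤n⊔m x (maxPart l)) p)

conj-below-max : ∀ i l → i < maxPart l → 0 < conj i l
conj-below-max i (x ∷ l) p rewrite conj-cons i x l with i <? x
... | yes q rewrite ind-< q = z<s
... | no q  = ≤-trans (conj-below-max i l i<max) (m≤n+m _ _)
  where
  i<max : i < maxPart l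
  i<max with ≤-total x (maxPart l)
  ... | inj₁ x≤m = subst (i <_) (m≤n⇒m⊔n≡n x≤m) p
  ... | inj₂ m≤x = ⊥-elim (q (subst (i <_) (m≥n⇒m⊔n≡m m≤x) p))

get-map-applyUpTo : ∀ (f g : ℕ → ℕ) m i → i < m → get (map f (applyUpTo g m)) i ≡ f (g i)
get-map-applyUpTo f g (suc m) zero    p       = refl
get-map-applyUpTo f g (suc m) (suc i) (s≤s p) = get-map-applyUpTo f (λ k → g (suc k)) m i p

get-map-applyUpTo-beyond : ∀ (f g : ℕ → ℕ) m i → m ≤ i → get (map f (applyUpTo g m)) i ≡ 0
get-map-applyUpTo-beyond f g zero    i       p       = refl
get-map-applyUpTo-beyond f g (suc m) (suc i) (s≤s p) = get-map-applyUpTo-beyond f (λ k → g (suc k)) m i p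

sum-map-applyUpTo : ∀ (f g : ℕ → ℕ) m → sum (map f (applyUpTo g m)) ≡ ∑ m (λ i → f (g i))
sum-map-applyUpTo f g zero    = refl
sum-map-applyUpTo f g (suc m) = cong (f (g 0) +_) (sum-map-applyUpTo f (λ k → g (suc k)) m)

get-dual : ∀ l i → get (dual l) i ≡ conj i l
get-dual l i with i <? maxPart l
... | yes p = get-map-applyUpTo (λ i → conj i l) (λ k → k) (maxPart l) i p
... | no p  = trans (get-map-applyUpTo-beyond (λ i → conj i l) (λ k → k) (maxPart l) i (≮⇒≥ p))
                    (sym (conj-beyond-max i l (≮⇒≥ p)))

-- The entries of l^∨ are positive; needed to compare l^∨ lexicographically.
dual-positive : ∀ l → All (0 <_) (dual l)
dual-positive l = map⁺ (applyUpTo⁺₁ (λ k → k) (maxPart l) (λ {i} p → conj-below-max i l p))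

∑-conj : ∀ m l → ∑ m (λ i → conj i l) ≡ minSum m l
∑-conj m []      = trans (∑-const m 0) (*-zeroʳ m)
∑-conj m (x ∷ l) = begin
  ∑ m (λ i → conj i (x ∷ l))          ≡⟨ ∑-cong m (λ i _ → conj-cons i x l) ⟩
  ∑ m (λ i → ind i x + conj i l)      ≡⟨ ∑-+ m (λ i → ind i x) (λ i → conj i l) ⟩
  ∑ m (λ i → ind i x) + ∑ m (λ i → conj i l) ≡⟨ cong₂ _+_ (∑-ind m x) (∑-conj m l) ⟩
  m ⊓ x + minSum m l                  ∎
  where open ≡-Reasoning

minSum-beyond-max : ∀ m l → maxPart l ≤ m → minSum m l ≡ sum l
minSum-beyond-max m []      p = refl
minSum-beyond-max m (x ∷ l) p =
  cong₂ _+_ (trans (⊓-comm m x) (m≤n⇒m⊓n≡m (≤-trans (m≤m⊔n x (maxPart l)) p)))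
            (minSum-beyond-max m l (≤-trans (m≤n⊔m x (maxPart l)) p))

sum-dual : ∀ l → sum (dual l) ≡ sum l
sum-dual l = trans (sum-map-applyUpTo (λ i → conj i l) (λ k → k) (maxPart l))
                   (trans (∑-conj (maxPart l) l) (minSum-beyond-max (maxPart l) l ≤-refl))

-- The Young diagram of a weakly decreasing l: cell (j , i) lies in row j and
-- column i, and j < (l^∨)_i ⇔ i < l_j.
Decreasing : List ℕ → Set
Decreasing = Linked (λ a b → b ≤ a)

head-bounds : ∀ {x l} → Decreasing (x ∷ l) → All (_≤ x) l
head-bounds [-]       = []
head-bounds (r ∷ dec) = Linked⇒All (λ p q → ≤-trans q p) r dec

get-≤-bound : ∀ {x l} → All (_≤ x) l → ∀ j → get l j ≤ x
get-≤-bound []       j       = z≤n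
get-≤-bound (p ∷ ps) zero    = p
get-≤-bound (p ∷ ps) (suc j) = get-≤-bound ps j

conj-of-small : ∀ {i l} → All (_≤ i) l → conj i l ≡ 0
conj-of-small {i} {[]}    []       = refl
conj-of-small {i} {x ∷ l} (p ∷ ps) rewrite conj-cons i x l | ind-≥ p = conj-of-small ps

conj⇒row : ∀ {l} → Decreasing l → ∀ i j → j < conj i l → i < get l j
conj⇒row {x ∷ l} dec i j p rewrite conj-cons i x l with i <? x
... | no q rewrite ind-≥ (≮⇒≥ q) | conj-of-small (All.map (λ r → ≤-trans r (≮⇒≥ q)) (head-bounds dec)) =
  ⊥-elim (<⇒≱ p z≤n)
conj⇒row {x ∷ l} dec i zero    p | yes q = q
conj⇒row {x ∷ l} dec i (suc j) p | yes q rewrite ind-< q = conj⇒row (Linked.tail dec) i j (≤-pred p)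

row⇒conj : ∀ {l} → Decreasing l → ∀ i j → i < get l j → j < conj i l
row⇒conj {x ∷ l} dec i zero    p rewrite conj-cons i x l | ind-< p = z<s
row⇒conj {x ∷ l} dec i (suc j) p
  rewrite conj-cons i x l | ind-< (<-≤-trans p (get-≤-bound (head-bounds dec) j)) =
  s≤s (row⇒conj (Linked.tail dec) i j p)

-- Maps of Fin n viewed as maps of ℕ (arbitrary value 0 outside [0, n)), so
-- that the block arithmetic above applies to positions and values.

liftℕ : ∀ {n} → (Fin n → Fin n) → ℕ → ℕ
liftℕ {n} f x with x <? n
... | yes p = toℕ (f (fromℕ< p))
... | no _  = 0

liftℕ-fromℕ< : ∀ {n} (f : Fin n → Fin n) x (p : x < n) → liftℕ f x ≡ toℕ (f (fromℕ< p))
liftℕ-fromℕ< {n} f x p with x <? n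
... | yes p′ = cong (λ i → toℕ (f i)) (fromℕ<-cong x x refl p′ p)
... | no q   = ⊥-elim (q p)

liftℕ-toℕ : ∀ {n} (f : Fin n → Fin n) (i : Fin n) → liftℕ f (toℕ i) ≡ toℕ (f i)
liftℕ-toℕ f i = trans (liftℕ-fromℕ< f (toℕ i) (toℕ<n i)) (cong (λ k → toℕ (f k)) (fromℕ<-toℕ i (toℕ<n i)))

liftℕ-< : ∀ {n} (f : Fin n → Fin n) x → x < n → liftℕ f x < n
liftℕ-< f x p = subst (_< _) (sym (liftℕ-fromℕ< f x p)) (toℕ<n _)

liftℕ-inverse : ∀ {n} (f g : Fin n → Fin n) → (∀ i → g (f i) ≡ i) → ∀ x → x < n → liftℕ g (liftℕ f x) ≡ x
liftℕ-inverse {n} f g inv x p =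
  trans (liftℕ-fromℕ< g (liftℕ f x) q)
    (trans (cong (λ k → toℕ (g k)) (trans (fromℕ<-cong (liftℕ f x) (toℕ (f (fromℕ< p))) (liftℕ-fromℕ< f x p) q q′)
                                         (fromℕ<-toℕ _ q′)))
      (trans (cong toℕ (inv (fromℕ< p))) (toℕ-fromℕ< p)))
  where
  q  = liftℕ-< f x p
  q′ = toℕ<n (f (fromℕ< p))

∑-tabulate : ∀ n (F : Fin n → ℕ) (h : ℕ → ℕ) → (∀ i → F i ≡ h (toℕ i)) → VF.foldr _+_ 0 F ≡ ∑ n h
∑-tabulate zero    F h e = refl
∑-tabulate (suc n) F h e = cong₂ _+_ (e Fin.zero) (∑-tabulate n (λ i → F (Fin.suc i)) (λ x → h (suc x)) (λ i → e (Fin.suc i)))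

∑-permute-ℕ : ∀ {n} (π : Permutation′ n) (g : ℕ → ℕ) → ∑ n (λ x → g (liftℕ (π ⟨$⟩ʳ_) x)) ≡ ∑ n g
∑-permute-ℕ {n} π g =
  trans (sym (∑-tabulate n (λ i → g (toℕ (π ⟨$⟩ʳ i))) _ (λ i → cong g (sym (liftℕ-toℕ (π ⟨$⟩ʳ_) i)))))
   (trans (sym (∑-permute (λ i → g (toℕ i)) π)) (∑-tabulate n (λ i → g (toℕ i)) g (λ i → refl)))

module DecreasingSelfMap (m : ℕ) (g : ℕ → ℕ) (g< : ∀ j → j < m → g j < m)
                         (g-dec : ∀ j → suc j < m → g (suc j) < g j) where

  lower : ∀ d j → j + d < m → d ≤ g j
  lower zero    j p = z≤n
  lower (suc d) j p = <-≤-trans (s≤s (lower d (suc j) p′)) (g-dec j (≤-<-trans (s≤s (m≤m+n j d)) p′))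
    where p′ = subst (_< m) (+-suc j d) p

  upper : ∀ j → j < m → g j + j < m
  upper zero    p = subst (_< m) (sym (+-identityʳ (g 0))) (g< 0 p)
  upper (suc j) p = ≤-<-trans (≤-reflexive (+-suc (g (suc j)) j))
                      (≤-<-trans (+-monoˡ-≤ j (g-dec j p)) (upper j (<-trans (n<1+n j) p)))

  reversal : ∀ j → j < m → g j ≡ m ∸ suc j
  reversal j p = ≤-antisym (≤-trans (≤-reflexive (sym (m+n∸n≡m (g j) (suc j))))
                                    (∸-monoˡ-≤ (suc j) (subst (_≤ m) (sym (+-suc (g j) j)) (upper j p))))
                           (lower (m ∸ suc j) j (≤-reflexive (m+[n∸m]≡n p)))

-- Descent conditions of a permutation, read on ℕ.  W is w (on positions) and
-- U is w⁻¹ (on values).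
module Descents {n : ℕ} (π : Permutation′ n) where

  W U : ℕ → ℕ
  W = liftℕ (π ⟨$⟩ʳ_)
  U = liftℕ (π ⟨$⟩ˡ_)

  W< : ∀ x → x < n → W x < n
  W< = liftℕ-< (π ⟨$⟩ʳ_)

  U∘W : ∀ x → x < n → U (W x) ≡ x
  U∘W = liftℕ-inverse (π ⟨$⟩ʳ_) (π ⟨$⟩ˡ_) (λ _ → inverseˡ π)

  desL⇔ : ∀ k (h : suc k < n) → InDesL π k h ⇔ U (suc k) < U k
  desL⇔ k h = mk⇔ (subst₂ _<_ (sym (liftℕ-fromℕ< _ (suc k) h)) (sym (liftℕ-fromℕ< _ k k<n)))
                  (subst₂ _<_ (liftℕ-fromℕ< _ (suc k) h) (liftℕ-fromℕ< _ k k<n))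
    where k<n = <-trans (n<1+n k) h

  desR⇔ : ∀ k (h : suc k < n) → InDesR π k h ⇔ W (suc k) < W k
  desR⇔ k h = mk⇔ (subst₂ _<_ (sym (liftℕ-fromℕ< _ (suc k) h)) (sym (liftℕ-fromℕ< _ k k<n)))
                  (subst₂ _<_ (liftℕ-fromℕ< _ (suc k) h) (liftℕ-fromℕ< _ k k<n))
    where k<n = <-trans (n<1+n k) h

  module _ (L M : List ℕ) where

    InD⇒U-decreasing : InD n (𝕁 L) (J M) π →
      ∀ y → suc y < n → offset (dual L) (suc y) ≢ 0 → U (suc y) < U y
    InD⇒U-decreasing d y h nz =
      Equivalence.to (desL⇔ y h)
        (Equivalence.from (proj₁ d y h) (λ notJ → notJ (λ m → nz (boundary⇒offset≡0 (dual L) (suc y) m))))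

    InD⇒W-increasing : InD n (𝕁 L) (J M) π →
      ∀ x → suc x < n → offset M (suc x) ≢ 0 → W x < W (suc x)
    InD⇒W-increasing d x h nz with <-cmp (W x) (W (suc x))
    ... | tri< lt _ _ = lt
    ... | tri≈ _ eq _ = ⊥-elim (1+n≢n (trans (sym (U∘W (suc x) h)) (trans (cong U (sym eq)) (U∘W x (<-trans (n<1+n x) h)))))
    ... | tri> _ _ gt = ⊥-elim (proj₂ d x h (Equivalence.from (desR⇔ x h) gt) (λ m → nz (boundary⇒offset≡0 M (suc x) m)))

    InD-intro : sum (dual L) ≡ n → sum M ≡ n →
      (∀ y → suc y < n → offset (dual L) (suc y) ≢ 0 → U (suc y) < U y) →
      (∀ y → suc y < n → offset (dual L) (suc y) ≡ 0 → U y < U (suc y)) →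
      (∀ x → suc x < n → offset M (suc x) ≢ 0 → W x < W (suc x)) →
      InD n (𝕁 L) (J M) π
    InD-intro sa sM U-dec U-asc W-inc = left , right
      where
      left : ∀ k (h : suc k < n) → InDesL π k h ⇔ (¬ 𝕁 L (suc k))
      left k h = mk⇔ to from
        where
        to : InDesL π k h → ¬ 𝕁 L (suc k)
        to d notJ = notJ λ m → <-asym (Equivalence.to (desL⇔ k h) d)
                                      (U-asc k h (boundary⇒offset≡0 (dual L) (suc k) m))
        from : ¬ 𝕁 L (suc k) → InDesL π k h
        from notJ = Equivalence.from (desL⇔ k h) (U-dec k h λ z →
          notJ (λ notB → notB (offset≡0⇒boundary (dual L) (suc k) z<s (subst (suc k <_) (sym sa) h) z)))
      right : ∀ k (h : suc k < n) → InDesR π k h → ¬ J M (suc k)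
      right k h d notB = <-asym (Equivalence.to (desR⇔ k h) d)
        (W-inc k h λ z → notB (offset≡0⇒boundary M (suc k) z<s (subst (suc k <_) (sym sM) h) z))

module KeyInequality {n : ℕ} (π : Permutation′ n) (L M : List ℕ) (d : InD n (𝕁 L) (J M) π) where
  open Descents π

  private
    a = dual L

  U-decreasing-in-block : ∀ y y′ → y < y′ → y′ < n → block a y ≡ block a y′ → U y′ < U y
  U-decreasing-in-block y (suc z) (s≤s y≤z) z<n same with m≤n⇒m<n∨m≡n y≤z
  ... | inj₂ refl = InD⇒U-decreasing L M d z z<n
                      (λ z₀ → <-irrefl same (proj₁ (offset-wrap a z z₀)))
  ... | inj₁ y<z = <-trans (InD⇒U-decreasing L M d z z<n not-start)
                           (U-decreasing-in-block y z y<z (<-trans (n<1+n z) z<n) same′)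
    where
    by≤bz : block a y ≤ block a z
    by≤bz = block-mono a (<⇒≤ y<z)
    same′ : block a y ≡ block a z
    same′ = ≤-antisym by≤bz (subst (block a z ≤_) (sym same) (block-mono a (n≤1+n z)))
    not-start : offset a (suc z) ≢ 0
    not-start z₀ = <⇒≱ (proj₁ (offset-wrap a z z₀)) (subst (_≤ block a z) same by≤bz)

  -- Induction along an M-block: consecutive positions go to increasing values
  -- in strictly increasing a-blocks.
  offset≤block′ : ∀ r x → x < n → offset M x ≡ r → r ≤ block a (W x)
  offset≤block′ zero    x       x<n e = z≤n
  offset≤block′ (suc r) zero    x<n e = ⊥-elim (0≢1+n (trans (sym (offset-0 M)) e))
  offset≤block′ (suc r) (suc x) x<n e = ≤-<-trans previous next-block
    where
    not-start : offset M (suc x) ≢ 0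
    not-start z = 0≢1+n (trans (sym z) e)
    previous : r ≤ block a (W x)
    previous = offset≤block′ r x (<-trans (n<1+n x) x<n)
                 (suc-injective (trans (sym (proj₂ (offset-step M x not-start))) e))
    W-inc : W x < W (suc x)
    W-inc = InD⇒W-increasing L M d x x<n not-start
    next-block : block a (W x) < block a (W (suc x))
    next-block = ≤∧≢⇒< (block-mono a (<⇒≤ W-inc)) λ same →
      <⇒≱ (U-decreasing-in-block (W x) (W (suc x)) W-inc (W< (suc x) x<n) same)
          (subst₂ _≤_ (sym (U∘W x (<-trans (n<1+n x) x<n))) (sym (U∘W (suc x) x<n)) (n≤1+n x))

  offset≤block : ∀ x → x < n → offset M x ≤ block a (W x)
  offset≤block x x<n = offset≤block′ (offset M x) x x<n refl

-- Counting the positions sent into the first t+1 blocks of L^∨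
-- shows that the partial sums of L^∨ are dominated by those of M^∨.
dominance : ∀ n (L M : List ℕ) → sum L ≡ n → sum M ≡ n → (w : Permutation′ n) →
            InD n (𝕁 L) (J M) w → ∀ t → ∑ (suc t) (get (dual L)) ≤ ∑ (suc t) (get (dual M))
dominance n L M sL sM w d t = begin
  ∑ (suc t) (get a)                                 ≡⟨ ∑-get (suc t) a ⟩
  psum a (suc t)                                    ≡⟨ count-blocks≤ a t ⟨
  ∑ (sum a) (λ y → ind (block a y) (suc t))         ≡⟨ cong (λ m → ∑ m (λ y → ind (block a y) (suc t))) sa ⟩
  ∑ n (λ y → ind (block a y) (suc t))               ≡⟨ ∑-permute-ℕ w (λ y → ind (block a y) (suc t)) ⟨
  ∑ n (λ x → ind (block a (W x)) (suc t))           ≤⟨ ∑-mono-≤ n (λ x x<n → ind-antitone (suc t) (offset≤block x x<n)) ⟩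
  ∑ n (λ x → ind (offset M x) (suc t))              ≡⟨ cong (λ m → ∑ m (λ x → ind (offset M x) (suc t))) sM ⟨
  ∑ (sum M) (λ x → ind (offset M x) (suc t))        ≡⟨ count-offsets≤ M t ⟩
  minSum (suc t) M                                  ≡⟨ ∑-conj (suc t) M ⟨
  ∑ (suc t) (λ i → conj i M)                        ≡⟨ ∑-cong (suc t) (λ i _ → get-dual M i) ⟨
  ∑ (suc t) (get (dual M))                          ∎
  where
  open ≤-Reasoning
  open Descents w using (W)
  open KeyInequality w L M d using (offset≤block)
  a = dual L
  sa : sum a ≡ n
  sa = trans (sum-dual L) sL

-- A strict lexicographic comparison with a list of positive entries has a
-- first difference (a shorter prefix counts as an entry 0).
lex-first-difference : ∀ {c a} → All (0 <_) a → c <lex a →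
  ∃[ t ] ((∀ i → i < t → get c i ≡ get a i) × get c t < get a t)
lex-first-difference (p ∷ ps) halt      = 0 , (λ i ()) , p
lex-first-difference (p ∷ ps) (this lt) = 0 , (λ i ()) , lt
lex-first-difference (p ∷ ps) (next refl rest) with lex-first-difference ps rest
... | t , agree , lt = suc t , (λ { zero _ → refl ; (suc i) (s≤s q) → agree i q }) , lt

-- Part (1): if M^∨ <lex L^∨ then 𝒟(𝕁_L, J_M) is empty, as the first
-- difference contradicts `dominance`.
vanishing : ∀ n (L M : List ℕ) → sum L ≡ n → sum M ≡ n → dual M <lex dual L →
            (w : Permutation′ n) → ¬ InD n (𝕁 L) (J M) w
vanishing n L M sL sM M<L w d with lex-first-difference (dual-positive L) M<L
... | t , agree , lt = <⇒≱ (∑-<-first-difference t (get (dual M)) (get (dual L)) agree lt)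
                           (dominance n L M sL sM w d t)

-- Let a = L^∨ for a partition L of n.  The cell in row j, column r
-- of the Young diagram of L is the position psum L j + r; π₀ sends it to the
-- value psum a r + (a_r ∸ 1 ∸ j), i.e. column r onto a-block r read upwards.
-- π₀ lies in 𝒟(𝕁_L, J_L), and any element of 𝒟(𝕁_L, J_L) equals π₀.

reverse< : ∀ {j m} → j < m → m ∸ suc j < m
reverse< {j} {suc m} (s≤s p) = s≤s (m∸n≤m m j)

reverse-involutive : ∀ {j m} → j < m → m ∸ suc (m ∸ suc j) ≡ j
reverse-involutive {j} {suc m} (s≤s p) = m∸[m∸n]≡n p

reverse-suc : ∀ {j m} → suc j < m → m ∸ suc j ≡ suc (m ∸ suc (suc j))
reverse-suc {j} {suc m} (s≤s q) = +-∸-assoc 1 q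

module Diagram (n : ℕ) (L : List ℕ) (dec : Decreasing L) (sL : sum L ≡ n) where
  a : List ℕ
  a = dual L

  sa : sum a ≡ n
  sa = trans (sum-dual L) sL

  column⇒row : ∀ {i j} → j < get a i → i < get L j
  column⇒row {i} {j} p = conj⇒row dec i j (subst (j <_) (get-dual L i) p)

  row⇒column : ∀ {i j} → i < get L j → j < get a i
  row⇒column {i} {j} p = subst (j <_) (sym (get-dual L i)) (row⇒conj dec i j p)

  cellL< : ∀ j r → r < get L j → psum L j + r < n
  cellL< j r p = subst (psum L j + r <_) sL (cell<sum L j r p)

  cella< : ∀ i q → q < get a i → psum a i + q < n
  cella< i q p = subst (psum a i + q <_) sa (cell<sum a i q p)

  offsetL< : ∀ x → x < n → offset L x < get L (block L x)
  offsetL< x p = offset<get L x (subst (x <_) (sym sL) p)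

  offseta< : ∀ y → y < n → offset a y < get a (block a y)
  offseta< y p = offset<get a y (subst (y <_) (sym sa) p)

  W₀ U₀ : ℕ → ℕ
  W₀ x = psum a (offset L x) + (get a (offset L x) ∸ suc (block L x))
  U₀ y = psum L (get a (block a y) ∸ suc (offset a y)) + block a y

  W₀-cell : ∀ j r → r < get L j → W₀ (psum L j + r) ≡ psum a r + (get a r ∸ suc j)
  W₀-cell j r p with block-offset-cell L j r p
  ... | e₁ , e₂ rewrite e₁ | e₂ = refl

  U₀-cell : ∀ i q → q < get a i → U₀ (psum a i + q) ≡ psum L (get a i ∸ suc q) + i
  U₀-cell i q p with block-offset-cell a i q p
  ... | e₁ , e₂ rewrite e₁ | e₂ = refl

  W₀< : ∀ x → x < n → W₀ x < n
  W₀< x p = cella< (offset L x) _ (reverse< (row⇒column (offsetL< x p)))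

  U₀< : ∀ y → y < n → U₀ y < n
  U₀< y p = cellL< _ (block a y) (column⇒row (reverse< (offseta< y p)))

  U₀∘W₀ : ∀ x → x < n → U₀ (W₀ x) ≡ x
  U₀∘W₀ x p = begin
    U₀ (W₀ x)                                 ≡⟨ U₀-cell r (get a r ∸ suc j) (reverse< j<ar) ⟩
    psum L (get a r ∸ suc (get a r ∸ suc j)) + r ≡⟨ cong (λ k → psum L k + r) (reverse-involutive j<ar) ⟩
    psum L j + r                              ≡⟨ psum-block+offset L x ⟩
    x                                         ∎
    where
    open ≡-Reasoning
    j = block L x
    r = offset L x
    j<ar = row⇒column (offsetL< x p)

  W₀∘U₀ : ∀ y → y < n → W₀ (U₀ y) ≡ y
  W₀∘U₀ y p = begin
    W₀ (U₀ y)                                 ≡⟨ W₀-cell (get a i ∸ suc q) i (column⇒row (reverse< q<ai)) ⟩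
    psum a i + (get a i ∸ suc (get a i ∸ suc q)) ≡⟨ cong (psum a i +_) (reverse-involutive q<ai) ⟩
    psum a i + q                              ≡⟨ psum-block+offset a y ⟩
    y                                         ∎
    where
    open ≡-Reasoning
    i = block a y
    q = offset a y
    q<ai = offseta< y p

  π₀ : Permutation′ n
  π₀ = permutation (λ i → fromℕ< (W₀< (toℕ i) (toℕ<n i))) (λ i → fromℕ< (U₀< (toℕ i) (toℕ<n i)))
         (λ y → toℕ-injective (trans (toℕ-fromℕ< _) (trans (cong W₀ (toℕ-fromℕ< _)) (W₀∘U₀ (toℕ y) (toℕ<n y)))))
         (λ x → toℕ-injective (trans (toℕ-fromℕ< _) (trans (cong U₀ (toℕ-fromℕ< _)) (U₀∘W₀ (toℕ x) (toℕ<n x)))))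

  open Descents π₀ using (InD-intro) renaming (W to Wπ₀; U to Uπ₀)

  Wπ₀≡W₀ : ∀ x → x < n → Wπ₀ x ≡ W₀ x
  Wπ₀≡W₀ x p = trans (liftℕ-fromℕ< _ x p) (trans (toℕ-fromℕ< _) (cong W₀ (toℕ-fromℕ< p)))

  Uπ₀≡U₀ : ∀ y → y < n → Uπ₀ y ≡ U₀ y
  Uπ₀≡U₀ y p = trans (liftℕ-fromℕ< _ y p) (trans (toℕ-fromℕ< _) (cong U₀ (toℕ-fromℕ< p)))

  -- Inside a-block i, stepping from offset q to q+1 moves U₀ up one row.
  U₀-decreasing : ∀ k → suc k < n → offset a (suc k) ≢ 0 → U₀ (suc k) < U₀ k
  U₀-decreasing k h nz = begin-strict
    U₀ (suc k)                ≡⟨ cong₂ (λ u v → psum L (get a u ∸ suc v) + u) same-block next-offset ⟩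
    psum L j + i              <⟨ +-monoʳ-< (psum L j) (column⇒row (reverse< q+1<ai)) ⟩
    psum L j + get L j        ≡⟨ psum-suc L j ⟩
    psum L (suc j)            ≤⟨ m≤m+n (psum L (suc j)) i ⟩
    psum L (suc j) + i        ≡⟨ cong (λ t → psum L t + i) (reverse-suc q+1<ai) ⟨
    U₀ k                      ∎
    where
    open ≤-Reasoning
    i = block a k
    q = offset a k
    same-block = proj₁ (offset-step a k nz)
    next-offset = proj₂ (offset-step a k nz)
    q+1<ai : suc q < get a i
    q+1<ai = subst₂ (λ u v → u < get a v) next-offset same-block (offseta< (suc k) h)
    j = get a i ∸ suc (suc q)

  -- The last value of an a-block is sent to row 0, its own column.
  U₀-increasing-at-boundary : ∀ k → offset a (suc k) ≡ 0 → U₀ k < U₀ (suc k)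
  U₀-increasing-at-boundary k z = begin-strict
    U₀ k              ≡⟨ cong (λ t → psum L t + block a k) last-row ⟩
    block a k         <⟨ proj₁ (offset-wrap a k z) ⟩
    block a (suc k)   ≤⟨ m≤n+m _ _ ⟩
    U₀ (suc k)        ∎
    where
    open ≤-Reasoning
    last-row : get a (block a k) ∸ suc (offset a k) ≡ 0
    last-row = trans (cong (get a (block a k) ∸_) (proj₂ (offset-wrap a k z))) (n∸n≡0 (get a (block a k)))

  -- Along a row of the diagram, W₀ moves to the next a-block.
  W₀-increasing : ∀ k → suc k < n → offset L (suc k) ≢ 0 → W₀ k < W₀ (suc k)
  W₀-increasing k h nz = begin-strict
    W₀ k                          <⟨ +-monoʳ-< (psum a r) (reverse< (row⇒column (offsetL< k (<-trans (n<1+n k) h)))) ⟩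
    psum a r + get a r            ≡⟨ psum-suc a r ⟩
    psum a (suc r)                ≡⟨ cong (psum a) (proj₂ (offset-step L k nz)) ⟨
    psum a (offset L (suc k))     ≤⟨ m≤m+n _ _ ⟩
    W₀ (suc k)                    ∎
    where
    open ≤-Reasoning
    r = offset L k

  π₀∈𝒟 : InD n (𝕁 L) (J L) π₀
  π₀∈𝒟 = InD-intro L L sa sL
    (λ k h nz → subst₂ _<_ (sym (Uπ₀≡U₀ (suc k) h)) (sym (Uπ₀≡U₀ k (<-trans (n<1+n k) h))) (U₀-decreasing k h nz))
    (λ k h z → subst₂ _<_ (sym (Uπ₀≡U₀ k (<-trans (n<1+n k) h))) (sym (Uπ₀≡U₀ (suc k) h)) (U₀-increasing-at-boundary k z))
    (λ k h nz → subst₂ _<_ (sym (Wπ₀≡W₀ k (<-trans (n<1+n k) h))) (sym (Wπ₀≡W₀ (suc k) h)) (W₀-increasing k h nz))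

  -- For v ∈ 𝒟(𝕁_L, J_L) the key inequality is an equality at
  -- every position (the totals agree), so v sends column i into a-block i; as
  -- v⁻¹ decreases inside a-blocks, v reverses each column.
  module Uniqueness (v : Permutation′ n) (v∈𝒟 : InD n (𝕁 L) (J L) v) where
    open Descents v using (W; U; W<; U∘W)
    open KeyInequality v L L v∈𝒟 using (offset≤block; U-decreasing-in-block)

    block-W₀ : ∀ x → x < n → block a (W₀ x) ≡ offset L x
    block-W₀ x p = proj₁ (block-offset-cell a (offset L x) _ (reverse< (row⇒column (offsetL< x p))))

    -- Both v and π₀ permute [0, n), so Σ_x block a (v x) = Σ_x block a (π₀ x)
    -- = Σ_x offset L x.
    equal-totals : ∑ n (offset L) ≡ ∑ n (λ x → block a (W x))
    equal-totals = begin
      ∑ n (offset L)               ≡⟨ ∑-cong n (λ x p → trans (sym (block-W₀ x p)) (cong (block a) (sym (Wπ₀≡W₀ x p)))) ⟩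
      ∑ n (λ x → block a (Wπ₀ x))  ≡⟨ ∑-permute-ℕ π₀ (block a) ⟩
      ∑ n (block a)                ≡⟨ ∑-permute-ℕ v (block a) ⟨
      ∑ n (λ x → block a (W x))    ∎
      where open ≡-Reasoning

    column-preserved : ∀ x → x < n → offset L x ≡ block a (W x)
    column-preserved = ∑-≤-equality n offset≤block equal-totals

    module Column (i : ℕ) where
      X : ℕ → ℕ
      X j = psum L j + i

      X< : ∀ j → j < get a i → X j < n
      X< j j<ai = cellL< j i (column⇒row j<ai)

      X-increasing : ∀ j → j < get a i → X j < X (suc j)
      X-increasing j j<ai = +-monoˡ-< i (subst (psum L j <_) (psum-suc L j) (m<m+n (psum L j) (≤-<-trans z≤n (column⇒row j<ai))))

      block-WX : ∀ j → j < get a i → block a (W (X j)) ≡ i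
      block-WX j j<ai = trans (sym (column-preserved (X j) (X< j j<ai))) (proj₂ (block-offset-cell L j i (column⇒row j<ai)))

      g : ℕ → ℕ
      g j = offset a (W (X j))

      W-X : ∀ j → j < get a i → W (X j) ≡ psum a i + g j
      W-X j j<ai = trans (sym (psum-block+offset a (W (X j)))) (cong (λ t → psum a t + g j) (block-WX j j<ai))

      g< : ∀ j → j < get a i → g j < get a i
      g< j j<ai = subst (λ t → g j < get a t) (block-WX j j<ai) (offseta< (W (X j)) (W< _ (X< j j<ai)))

      -- v⁻¹ decreases inside a-block i while X increases, so g decreases.
      g-decreasing : ∀ j → suc j < get a i → g (suc j) < g j
      g-decreasing j j+1<ai with <-cmp (W (X j)) (W (X (suc j)))
      ... | tri< lt _ _ = ⊥-elim (<⇒≱ (U-decreasing-in-block (W (X j)) (W (X (suc j))) lt (W< _ (X< (suc j) j+1<ai))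
                                         (trans (block-WX j j<ai) (sym (block-WX (suc j) j+1<ai))))
                                       (subst₂ _≤_ (sym (U∘W (X j) (X< j j<ai))) (sym (U∘W (X (suc j)) (X< (suc j) j+1<ai)))
                                         (<⇒≤ (X-increasing j j<ai))))
        where j<ai = <-trans (n<1+n j) j+1<ai
      ... | tri≈ _ eq _ = ⊥-elim (<-irrefl (trans (sym (U∘W (X j) (X< j j<ai)))
                                             (trans (cong U eq) (U∘W (X (suc j)) (X< (suc j) j+1<ai))))
                                           (X-increasing j j<ai))
        where j<ai = <-trans (n<1+n j) j+1<ai
      ... | tri> _ _ gt = +-cancelˡ-< (psum a i) _ _
                            (subst₂ _<_ (W-X (suc j) j+1<ai) (W-X j (<-trans (n<1+n j) j+1<ai)) gt)

      g-reversal : ∀ j → j < get a i → g j ≡ get a i ∸ suc j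
      g-reversal = DecreasingSelfMap.reversal (get a i) g g< g-decreasing

    W≡W₀ : ∀ x → x < n → W x ≡ W₀ x
    W≡W₀ x p = begin
      W x                                ≡⟨ cong W (psum-block+offset L x) ⟨
      W (psum L j + i)                   ≡⟨ W-X j j<ai ⟩
      psum a i + g j                     ≡⟨ cong (psum a i +_) (g-reversal j j<ai) ⟩
      psum a i + (get a i ∸ suc j)       ∎
      where
      open ≡-Reasoning
      j = block L x
      i = offset L x
      j<ai = row⇒column (offsetL< x p)
      open Column i using (W-X; g; g-reversal)

    unique : v ≈ₚ π₀
    unique k = toℕ-injective (begin
      toℕ (v ⟨$⟩ʳ k)   ≡⟨ liftℕ-toℕ _ k ⟨
      W (toℕ k)        ≡⟨ W≡W₀ (toℕ k) (toℕ<n k) ⟩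
      W₀ (toℕ k)       ≡⟨ Wπ₀≡W₀ (toℕ k) (toℕ<n k) ⟨
      Wπ₀ (toℕ k)      ≡⟨ liftℕ-toℕ _ k ⟩
      toℕ (π₀ ⟨$⟩ʳ k)  ∎)
      where open ≡-Reasoning

theorem4p5 : (n : ℕ) → 1 ≤ n → (λ′ μ : Par n) →
    (μ ≺ λ′ → (w : Permutation′ n) → ¬ InD n (𝕁 (parts λ′)) (J (parts μ)) w) ×
    (∃[ w ] (InD n (𝕁 (parts λ′)) (J (parts λ′)) w ×
      ((v : Permutation′ n) → InD n (𝕁 (parts λ′)) (J (parts λ′)) v → v ≈ₚ w)))
theorem4p5 n _ λ′ μ =
  vanishing n (parts λ′) (parts μ) (sums λ′) (sums μ) ,
  (π₀ , π₀∈𝒟 , Uniqueness.unique)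
  where open Diagram n (parts λ′) (decreasing λ′) (sums λ′)
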